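{- Let $T$ be a tree, $\ell$ a leaf vertex of $T$, and $v$ the unique neighbor of $\ell$ in $T$. Then $$T_{\mathrm{Cone}(T)}(x,y) = x\cdot T_{\mathrm{Cone}(T-\ell)}(x,y) + T_{\mathrm{Cone}^{(+v)}(T-\ell)}(x,y),$$ $$T_{\mathrm{Cone}^{(+\ell)}(T)}(x,y) = T_{\mathrm{Cone}(T)}(x,y) + y\cdot T_{\mathrm{Cone}^{(+v)}(T-\ell)}(x,y).$$ Consequently, setting $x=1$, $$T_{\mathrm{Cone}(T)}(1,y) = T_{\mathrm{Cone}(T-\ell)}(1,y) + T_{\mathrm{Cone}^{(+v)}(T-\ell)}(1,y),\qquad T_{\mathrm{Cone}^{(+\ell)}(T)}(1,y) = T_{\mathrm{Cone}(T)}(1,y) + y\cdot T_{\mathrm{Cone}^{(+v)}(T-\ell)}(1,y).$$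
   Context: $T_G(x,y)$ is the Tutte polynomial of a finite graph $G$ (loops and parallel edges allowed), defined recursively by: $T_G=T_{G\setminus e}+T_{G/e}$ if $e$ is neither a loop nor a coloop; $T_G=y\,T_{G\setminus e}$ if $e$ is a loop; $T_G=x\,T_{G/e}$ if $e$ is a coloop (bridge); $T_G=1$ if $G$ has no edges. For a tree $T$, $\mathrm{Cone}(T)$ is obtained by adding a new cone vertex $v_0$ joined by one edge to each vertex of $T$; for a vertex $u$ of $T$, $\mathrm{Cone}^{(+u)}(T)$ is obtained from $\mathrm{Cone}(T)$ by adding a second edge parallel to $\{v_0,u\}$. $T-\ell$ denotes the tree obtained by deleting $\ell$ and its incident edge. -}

module Defs where

open import Level using (Level)
open import Data.Nat using (ℕ; zero; suc) renaming (_+_ to _+ℕ_)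
open import Data.Fin using (Fin; zero; suc; punchOut; _≟_)
open import Data.Bool using (Bool; true; false; if_then_else_; _∧_; _∨_)
open import Data.Product using (_×_; _,_; proj₁; proj₂)
open import Data.Maybe using (Maybe; just; nothing)
open import Data.List using (List; []; _∷_; _++_; length; map; mapMaybe; allFin; removeAt; lookup)
open import Data.Nat.ListAction using (sum)
open import Data.Bool.ListAction using (any)
import Data.Vec as V
open import Data.List.Membership.Propositional using (_∈_)
open import Relation.Nullary using (¬_; does; yes; no)
open import Relation.Binary.PropositionalEquality using (_≡_; _≢_)
open import Algebra.Bundles using (CommutativeRing)

-- A finite multigraph on vertex set Fin n: a list of edges (loops and
-- parallel edges allowed; orientation of a pair is irrelevant).
Edge : ℕ → Set
Edge n = Fin n × Fin n

Graph : ℕ → Set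
Graph n = List (Edge n)

private
  variable
    n : ℕ

_==_ : Fin n → Fin n → Bool
a == b = does (a ≟ b)

step : Graph n → (Fin n → Bool) → (Fin n → Bool)
step es S b = S b ∨ any (λ e → (S (proj₁ e) ∧ (proj₂ e == b)) ∨ (S (proj₂ e) ∧ (proj₁ e == b))) es

iter : {A : Set} → ℕ → (A → A) → A → A
iter zero f a = a
iter (suc k) f a = f (iter k f a)

-- reachable? es u w = true iff w is reachable from u in the graph es
-- (a path has at most n - 1 edges, so n rounds of closure suffice).
reachable? : Graph n → Fin n → Fin n → Bool
reachable? {n} es u w = iter n (step es) (u ==_) w

-- The polynomial T_G ∈ ℤ[x,y] is
-- represented by its evaluation in an arbitrary commutative ring R at
-- arbitrary x y : R (a polynomial identity holds iff it holds under every
-- such evaluation; take R = ℤ[x,y]).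
--
-- Contraction of the edge (u , w) is realised by renaming w to u in the
-- remaining edges (w becomes an isolated vertex, which does not affect the
-- Tutte polynomial).  The edge (u , w) is a loop iff u = w, and a coloop
-- (bridge) iff it is not a loop and w is unreachable from u in G \ e.

ren : Fin n → Fin n → Fin n → Fin n
ren u w a = if a == w then u else a

contractWith : Fin n → Fin n → Edge n → Edge n
contractWith u w (a , b) = ren u w a , ren u w b

module _ {c ℓ : Level} (R : CommutativeRing c ℓ) where
  open CommutativeRing R

  tutteVec : Carrier → Carrier → (k : ℕ) → V.Vec (Edge n) k → Carrier
  tutteVec x y zero V.[] = 1#
  tutteVec x y (suc k) ((u , w) V.∷ es) =
    if u == w
      then y * tutteVec x y k es
      else (if reachable? (V.toList es) u w
              then tutteVec x y k es + tutteVec x y k (V.map (contractWith u w) es)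
              else x * tutteVec x y k (V.map (contractWith u w) es))

  Tutte : Carrier → Carrier → Graph n → Carrier
  Tutte x y G = tutteVec x y (length G) (V.fromList G)

data Path {n : ℕ} (es : Graph n) : Fin n → Fin n → Set where
  here : ∀ {a} → Path es a a
  fwd  : ∀ {a b c} → (a , b) ∈ es → Path es b c → Path es a c
  bwd  : ∀ {a b c} → (b , a) ∈ es → Path es b c → Path es a c

Connected : Graph n → Set
Connected es = ∀ a b → Path es a b

Acyclic : Graph n → Set
Acyclic es = ∀ (i : Fin (length es)) →
  (proj₁ (lookup es i) ≢ proj₂ (lookup es i)) ×
  ¬ Path (removeAt es i) (proj₁ (lookup es i)) (proj₂ (lookup es i))

IsTree : Graph n → Set
IsTree es = Connected es × Acyclic es

indicator : Fin n → Fin n → ℕ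
indicator a v = if a == v then 1 else 0

degree : Graph n → Fin n → ℕ
degree es v = sum (map (λ e → indicator (proj₁ e) v +ℕ indicator (proj₂ e) v) es)

IsLeaf : Graph n → Fin n → Set
IsLeaf es l = degree es l ≡ 1

Adjacent : Graph n → Fin n → Fin n → Set
Adjacent es a b = ((a , b) ∈ es) Data.Sum.⊎ ((b , a) ∈ es)
  where import Data.Sum

removeVertex : {m : ℕ} → Fin (suc m) → Fin (suc m) → Maybe (Fin m)
removeVertex l a with l ≟ a
... | yes _ = nothing
... | no l≢a = just (punchOut l≢a)

deleteEdgeEnds : {m : ℕ} → Fin (suc m) → Edge (suc m) → Maybe (Edge m)
deleteEdgeEnds l (a , b) with removeVertex l a | removeVertex l b
... | just a' | just b' = just (a' , b')
... | _ | _ = nothing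

deleteVertex : {m : ℕ} → Graph (suc m) → Fin (suc m) → Graph m
deleteVertex es l = mapMaybe (deleteEdgeEnds l) es

-- Cones.  The cone vertex v0 is zero; old vertex i becomes suc i.

Cone : Graph n → Graph (suc n)
Cone {n} es = map (λ e → suc (proj₁ e) , suc (proj₂ e)) es ++ map (λ i → zero , suc i) (allFin n)

ConePlus : Fin n → Graph n → Graph (suc n)
ConePlus u es = (zero , suc u) ∷ Cone es

-- Deleting and contracting the leaf edge {v, l} of Cone(T) gives the first identity: after deletion
-- the spoke at l is a bridge, and contraction merges l into v, so that spoke becomes a second edge
-- parallel to {v0, v}. Deleting and contracting one of the two spokes at l in Cone^(+l)(T) gives the
-- second: deletion leaves Cone(T), while contraction turns the other spoke at l into a loop and the
-- leaf edge into a spoke at v.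
--
-- Tutte always deletes and contracts the first edge of the edge list, so these steps rest on its
-- independence of the edge order, proved by induction on the number of edges. The essential case is
-- swapping two edges that cross the same cut, where one needs that the Tutte polynomial of a one-point
-- join does not depend on the vertices identified (SlideInvariant); that in turn is proved by moving
-- the joining vertex one edge at a time, using the edge-order independence for fewer edges.
module Submission where

open import Level using (Level)
open import Function.Base using (_∘_; id)
open import Function.Bundles using (Equivalence; _⇔_; mk⇔)
open import Function.Properties.Equivalence using () renaming (sym to ⇔-sym; trans to ⇔-trans)
open import Function.Definitions using (Injective)
open import Algebra.Bundles using (CommutativeRing)
open import Data.Empty using (⊥-elim)
open import Data.Product using (_×_; _,_; proj₁; proj₂; ∃-syntax)
open import Data.Sum using (_⊎_; inj₁; inj₂)
open import Data.Maybe using (nothing)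
open import Data.Bool using (Bool; true; false; T; if_then_else_; _∧_; _∨_)
open import Data.Bool.Properties using (T-∨; T-∧; T-≡; T?)
open import Data.Bool.ListAction using (any)
open import Data.Nat using (ℕ; zero; suc; _≤_; _<_; s≤s)
import Data.Nat.Properties as ℕ
open import Data.Fin using (Fin; punchIn; _≟_) renaming (zero to fz; suc to fs)
import Data.Fin.Properties as Fin
open import Data.Fin.Subset using (Subset; _⊂_; ∣_∣) renaming (_∈_ to _∈ˢ_)
open import Data.Fin.Subset.Properties using (∣p∣≤n; p⊂q⇒∣p∣<∣q∣; ∉⊥; ∣⊥∣≡0)
import Data.Vec as Vec
import Data.Vec.Properties as Vec
open import Data.List using (List; []; _∷_; _++_; map; length; mapMaybe; catMaybes; tabulate; allFin)
import Data.List.Properties as List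
open import Data.List.Relation.Unary.Any using (here; there)
open import Data.List.Relation.Unary.Any.Properties using (any⁺; any⁻)
open import Data.List.Membership.Propositional using (_∈_; find; lose)
open import Data.List.Membership.Propositional.Properties using (∈-map⁺; ∈-map⁻; ∈-∃++; ∈-++⁺ʳ; ∈-allFin)
open import Data.List.Relation.Binary.Subset.Propositional using (_⊆_)
open import Data.List.Relation.Binary.Permutation.Propositional as ↭ using (_↭_; ↭-sym)
open import Data.List.Relation.Binary.Permutation.Propositional.Properties
  using (∈-resp-↭; shift; map⁺; ++⁺; ↭-length; ↭-empty-inv)
open import Relation.Nullary using (¬_; Dec; yes; no; _→-dec_; _×-dec_)
open import Relation.Nullary.Decidable using (dec-true; dec-false; decidable-stable; map′)
open import Relation.Binary.PropositionalEquality
  using (_≡_; _≢_; refl; sym; trans; cong; cong₂; subst; subst₂; module ≡-Reasoning)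
import Relation.Binary.Reasoning.Setoid as ≈-Reasoning

open import Defs

open Equivalence using (to; from)

private variable
  k n : ℕ

==-refl : (a : Fin n) → (a == a) ≡ true
==-refl a = dec-true (a ≟ a) refl

≢⇒==-false : {a b : Fin n} → a ≢ b → (a == b) ≡ false
≢⇒==-false {a = a} {b} = dec-false (a ≟ b)

==-true⇒≡ : {a b : Fin n} → (a == b) ≡ true → a ≡ b
==-true⇒≡ {a = a} {b} eq with a ≟ b
... | yes a≡b = a≡b
==-true⇒≡ () | no _

==-false⇒≢ : {a b : Fin n} → (a == b) ≡ false → a ≢ b
==-false⇒≢ {a = a} eq refl with () ← trans (sym eq) (==-refl a)

-- Paths

module _ {G : Graph n} where

  path-trans : ∀ {a b c} → Path G a b → Path G b c → Path G a c
  path-trans here q = q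
  path-trans (fwd e p) q = fwd e (path-trans p q)
  path-trans (bwd e p) q = bwd e (path-trans p q)

  adjacent⇒path : ∀ {a b} → Adjacent G a b → Path G a b
  adjacent⇒path (inj₁ e) = fwd e here
  adjacent⇒path (inj₂ e) = bwd e here

  path-sym : ∀ {a b} → Path G a b → Path G b a
  path-sym here = here
  path-sym (fwd e p) = path-trans (path-sym p) (bwd e here)
  path-sym (bwd e p) = path-trans (path-sym p) (fwd e here)

path-mono : {H H′ : Graph n} → H ⊆ H′ → {a b : Fin n} → Path H a b → Path H′ a b
path-mono H⊆H′ here = here
path-mono H⊆H′ (fwd e p) = fwd (H⊆H′ e) (path-mono H⊆H′ p)
path-mono H⊆H′ (bwd e p) = bwd (H⊆H′ e) (path-mono H⊆H′ p)

path-↭ : {H H′ : Graph n} → H ↭ H′ → {a b : Fin n} → Path H a b → Path H′ a b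
path-↭ H↭H′ = path-mono (∈-resp-↭ H↭H′)

path-∷⁻ : {H : Graph n} {p q s t : Fin n} → Path ((p , q) ∷ H) s t →
  Path H s t ⊎ (Path H s p × Path H q t) ⊎ (Path H s q × Path H p t)
path-∷⁻ here = inj₁ here
path-∷⁻ (fwd (here refl) r) with path-∷⁻ r
... | inj₁ qt = inj₂ (inj₁ (here , qt))
... | inj₂ (inj₁ (qp , qt)) = inj₁ (path-trans (path-sym qp) qt)
... | inj₂ (inj₂ (_ , pt)) = inj₁ pt
path-∷⁻ (fwd (there e) r) with path-∷⁻ r
... | inj₁ st = inj₁ (fwd e st)
... | inj₂ (inj₁ (sp , qt)) = inj₂ (inj₁ (fwd e sp , qt))
... | inj₂ (inj₂ (sq , pt)) = inj₂ (inj₂ (fwd e sq , pt))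
path-∷⁻ (bwd (here refl) r) with path-∷⁻ r
... | inj₁ pt = inj₂ (inj₂ (here , pt))
... | inj₂ (inj₁ (_ , qt)) = inj₁ qt
... | inj₂ (inj₂ (pq , pt)) = inj₁ (path-trans (path-sym pq) pt)
path-∷⁻ (bwd (there e) r) with path-∷⁻ r
... | inj₁ st = inj₁ (bwd e st)
... | inj₂ (inj₁ (sp , qt)) = inj₂ (inj₁ (bwd e sp , qt))
... | inj₂ (inj₂ (sq , pt)) = inj₂ (inj₂ (bwd e sq , pt))

path-map : {H : Graph k} {H′ : Graph n} (f : Fin k → Fin n) →
  (∀ {a b} → (a , b) ∈ H → Path H′ (f a) (f b)) → {s t : Fin k} → Path H s t → Path H′ (f s) (f t)
path-map f edge here = here
path-map f edge (fwd e p) = path-trans (edge e) (path-map f edge p)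
path-map f edge (bwd e p) = path-trans (path-sym (edge e)) (path-map f edge p)

≡-along-path : ∀ {a} {A : Set a} {H : Graph k} (f : Fin k → A) →
  (∀ {s t} → (s , t) ∈ H → f s ≡ f t) → {s t : Fin k} → Path H s t → f s ≡ f t
≡-along-path f edge here = refl
≡-along-path f edge (fwd e p) = trans (edge e) (≡-along-path f edge p)
≡-along-path f edge (bwd e p) = trans (sym (edge e)) (≡-along-path f edge p)

Avoids : Graph n → Fin n → Set
Avoids H v = ∀ {e} → e ∈ H → proj₁ e ≢ v × proj₂ e ≢ v

path-to-avoided : {H : Graph n} {a c : Fin n} → Avoids H c → Path H a c → a ≡ c
path-to-avoided av here = refl
path-to-avoided av (fwd e p) with refl ← path-to-avoided av p = ⊥-elim (proj₂ (av e) refl)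
path-to-avoided av (bwd e p) with refl ← path-to-avoided av p = ⊥-elim (proj₁ (av e) refl)

path-single : {u w s t : Fin n} → Path ((u , w) ∷ []) s t → s ≡ t ⊎ (s ≡ u × t ≡ w) ⊎ (s ≡ w × t ≡ u)
path-single p with path-∷⁻ p
... | inj₁ st = inj₁ (path-to-avoided (λ ()) st)
... | inj₂ (inj₁ (su , wt)) = inj₂ (inj₁ (path-to-avoided (λ ()) su , sym (path-to-avoided (λ ()) wt)))
... | inj₂ (inj₂ (sw , ut)) = inj₂ (inj₂ (path-to-avoided (λ ()) sw , sym (path-to-avoided (λ ()) ut)))

path-∷-elim : {G : Graph n} {u w s t : Fin n} → Path G u w → Path ((u , w) ∷ G) s t → Path G s t
path-∷-elim uw st with path-∷⁻ st
... | inj₁ st′ = st′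
... | inj₂ (inj₁ (su , wt)) = path-trans su (path-trans uw wt)
... | inj₂ (inj₂ (sw , ut)) = path-trans sw (path-trans (path-sym uw) ut)

path-∷-detached : {H : Graph n} {c w s t : Fin n} → ¬ Path H s w → ¬ Path H t w → Path ((c , w) ∷ H) s t → Path H s t
path-∷-detached ¬sw ¬tw st with path-∷⁻ st
... | inj₁ st′ = st′
... | inj₂ (inj₁ (_ , wt)) = ⊥-elim (¬tw (path-sym wt))
... | inj₂ (inj₂ (sw , _)) = ⊥-elim (¬sw sw)

adjacent⇒↭ : {G : Graph n} {u z : Fin n} → Adjacent G u z →
  ∃[ G′ ] ∃[ e ] G ↭ e ∷ G′ × (e ≡ (u , z) ⊎ e ≡ (z , u))
adjacent⇒↭ (inj₁ e) with ys , zs , refl ← ∈-∃++ e = ys ++ zs , _ , shift _ ys zs , inj₁ refl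
adjacent⇒↭ (inj₂ e) with ys , zs , refl ← ∈-∃++ e = ys ++ zs , _ , shift _ ys zs , inj₂ refl

-- Reachability

T-ext : {a b : Bool} → (T a → T b) → (T b → T a) → a ≡ b
T-ext {false} {false} _ _ = refl
T-ext {false} {true} _ b⇒a = ⊥-elim (b⇒a _)
T-ext {true} {false} a⇒b _ = ⊥-elim (a⇒b _)
T-ext {true} {true} _ _ = refl

¬T⇒≡false : {b : Bool} → ¬ T b → b ≡ false
¬T⇒≡false {false} _ = refl
¬T⇒≡false {true} ¬t = ⊥-elim (¬t _)

module Reachability (G : Graph n) where

  private
    incident : (Fin n → Bool) → Fin n → Edge n → Bool
    incident S b e = (S (proj₁ e) ∧ (proj₂ e == b)) ∨ (S (proj₂ e) ∧ (proj₁ e == b))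

  step-cong : {S S′ : Fin n → Bool} → (∀ b → S b ≡ S′ b) → ∀ b → step G S b ≡ step G S′ b
  step-cong {S} {S′} h b = cong₂ _∨_ (h b) (any-cong G)
    where
      any-cong : ∀ es → any (incident S b) es ≡ any (incident S′ b) es
      any-cong [] = refl
      any-cong ((c , d) ∷ es) =
        cong₂ _∨_ (cong₂ _∨_ (cong (_∧ (d == b)) (h c)) (cong (_∧ (c == b)) (h d))) (any-cong es)

  step-⊇ : {S : Fin n → Bool} {b : Fin n} → T (S b) → T (step G S b)
  step-⊇ s = from T-∨ (inj₁ s)

  step-adjacent : {S : Fin n → Bool} {a b : Fin n} → T (S a) → Adjacent G a b → T (step G S b)
  step-adjacent {S} {b = b} s (inj₁ e) =
    from T-∨ (inj₂ (any⁺ (incident S b) (lose e (from T-∨ (inj₁ (from T-∧ (s , from T-≡ (==-refl b))))))))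
  step-adjacent {S} {b = b} s (inj₂ e) =
    from T-∨ (inj₂ (any⁺ (incident S b) (lose e (from T-∨ (inj₂ (from T-∧ (s , from T-≡ (==-refl b))))))))

  step-sound : {S : Fin n → Bool} {b : Fin n} → T (step G S b) → T (S b) ⊎ ∃[ a ] T (S a) × Adjacent G a b
  step-sound {S} {b} t with to T-∨ t
  ... | inj₁ s = inj₁ s
  ... | inj₂ t′ with find (any⁻ (incident S b) G t′)
  ... | (c , d) , e , r with to T-∨ r
  ... | inj₁ r₁ = let (sc , db) = to T-∧ r₁ in inj₂ (c , sc , inj₁ (subst (λ z → (c , z) ∈ G) (==-true⇒≡ (to T-≡ db)) e))
  ... | inj₂ r₂ = let (sd , cb) = to T-∧ r₂ in inj₂ (d , sd , inj₂ (subst (λ z → (z , d) ∈ G) (==-true⇒≡ (to T-≡ cb)) e))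

  Closed : (Fin n → Bool) → Set
  Closed S = ∀ b → T (step G S b) → T (S b)

  closed? : (S : Fin n → Bool) → Dec (Closed S)
  closed? S = Fin.all? (λ b → T? (step G S b) →-dec T? (S b))

  closed-path : {S : Fin n → Bool} {a c : Fin n} → Closed S → T (S a) → Path G a c → T (S c)
  closed-path cl s here = s
  closed-path cl s (fwd e p) = closed-path cl (cl _ (step-adjacent s (inj₁ e))) p
  closed-path cl s (bwd e p) = closed-path cl (cl _ (step-adjacent s (inj₂ e))) p

  closed-step : {S : Fin n → Bool} → Closed S → Closed (step G S)
  closed-step {S} cl b t = subst T (step-cong (λ c → T-ext (cl c) (step-⊇ {S})) b) t

  toSubset : (Fin n → Bool) → Subset n
  toSubset = Vec.tabulate

  ∈-toSubset⁺ : {S : Fin n → Bool} {b : Fin n} → T (S b) → b ∈ˢ toSubset S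
  ∈-toSubset⁺ {S} {b} s = Vec.lookup⇒[]= b _ (trans (Vec.lookup∘tabulate S b) (to T-≡ s))

  ∈-toSubset⁻ : {S : Fin n → Bool} {b : Fin n} → b ∈ˢ toSubset S → T (S b)
  ∈-toSubset⁻ {S} {b} m = from T-≡ (trans (sym (Vec.lookup∘tabulate S b)) (Vec.[]=⇒lookup m))

  step-⊃ : {S : Fin n → Bool} → ¬ Closed S → toSubset S ⊂ toSubset (step G S)
  step-⊃ {S} ¬cl with Fin.¬∀⟶∃¬ n _ (λ b → T? (step G S b) →-dec T? (S b)) ¬cl
  ... | b , ¬imp =
    (λ m → ∈-toSubset⁺ (step-⊇ {S} (∈-toSubset⁻ m))) , b ,
    ∈-toSubset⁺ (decidable-stable (T? _) (λ ¬t → ¬imp (λ t → ⊥-elim (¬t t)))) ,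
    (λ m → ¬imp (λ _ → ∈-toSubset⁻ m))

  -- n rounds suffice: until the iterate is closed it gains a vertex in every round.
  closed-or-large : {S : Fin n → Bool} {u : Fin n} → T (S u) → ∀ k →
    Closed (iter k (step G) S) ⊎ k < ∣ toSubset (iter k (step G) S) ∣
  closed-or-large {S} {u} su zero =
    inj₂ (subst (_< ∣ toSubset S ∣) (∣⊥∣≡0 n)
                (p⊂q⇒∣p∣<∣q∣ ((λ m → ⊥-elim (∉⊥ m)) , u , ∈-toSubset⁺ {S} su , ∉⊥)))
  closed-or-large {S} su (suc k) with closed? (iter k (step G) S) | closed-or-large su k
  ... | yes cl | _ = inj₁ (closed-step cl)
  ... | no ¬cl | inj₁ cl = ⊥-elim (¬cl cl)
  ... | no ¬cl | inj₂ large = inj₂ (ℕ.<-≤-trans (s≤s large) (p⊂q⇒∣p∣<∣q∣ (step-⊃ ¬cl)))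

  iter-⊇ : {S : Fin n → Bool} {b : Fin n} → ∀ k → T (S b) → T (iter k (step G) S b)
  iter-⊇ zero s = s
  iter-⊇ {S} (suc k) s = step-⊇ {iter k (step G) S} (iter-⊇ k s)

  iter-sound : {u b : Fin n} → ∀ k → T (iter k (step G) (u ==_) b) → Path G u b
  iter-sound {u} zero t = subst (Path G u) (==-true⇒≡ (to T-≡ t)) here
  iter-sound (suc k) t with step-sound t
  ... | inj₁ t′ = iter-sound k t′
  ... | inj₂ (a , t′ , adj) = path-trans (iter-sound k t′) (adjacent⇒path adj)

  reachable?-sound : {u w : Fin n} → T (reachable? G u w) → Path G u w
  reachable?-sound = iter-sound n

  reachable?-complete : {u w : Fin n} → Path G u w → T (reachable? G u w)
  reachable?-complete {u} p with closed-or-large {S = u ==_} (from T-≡ (==-refl u)) n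
  ... | inj₁ cl = closed-path {S = iter n (step G) (u ==_)} cl (iter-⊇ {S = u ==_} n (from T-≡ (==-refl u))) p
  ... | inj₂ large = ⊥-elim (ℕ.n≮n n (ℕ.<-≤-trans large (∣p∣≤n (toSubset (iter n (step G) (u ==_))))))

  path? : (u w : Fin n) → Dec (Path G u w)
  path? u w = map′ reachable?-sound reachable?-complete (T? (reachable? G u w))

-- Relabelling and contraction of vertices

mapEdge : (Fin k → Fin n) → Edge k → Edge n
mapEdge f e = f (proj₁ e) , f (proj₂ e)

relabel : (Fin k → Fin n) → Graph k → Graph n
relabel f = map (mapEdge f)

contract : Fin n → Fin n → Graph n → Graph n
contract u w = relabel (ren u w)

relabel-∘ : {n′ : ℕ} (f : Fin n → Fin n′) (g : Fin k → Fin n) (G : Graph k) →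
  relabel (f ∘ g) G ≡ relabel f (relabel g G)
relabel-∘ f g G = List.map-∘ G

path-relabel⁻ : {n′ : ℕ} (g : Fin k → Fin n) (f : Fin k → Fin n′) {H : Graph k} {H′ : Graph n′} →
  (∀ {a b} → (a , b) ∈ H → Path H′ (f a) (f b)) →
  (∀ {s s′} → g s ≡ g s′ → Path H′ (f s) (f s′)) →
  ∀ {α β} → Path (relabel g H) α β → ∀ {s t} → g s ≡ α → g t ≡ β → Path H′ (f s) (f t)
path-relabel⁻ g f edge fibre here gs gt = fibre (trans gs (sym gt))
path-relabel⁻ g f edge fibre (fwd e p) gs gt with ∈-map⁻ (mapEdge g) e
... | _ , e′ , refl = path-trans (fibre gs) (path-trans (edge e′) (path-relabel⁻ g f edge fibre p refl gt))
path-relabel⁻ g f edge fibre (bwd e p) gs gt with ∈-map⁻ (mapEdge g) e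
... | _ , e′ , refl = path-trans (fibre gs) (path-trans (path-sym (edge e′)) (path-relabel⁻ g f edge fibre p refl gt))

ren-merged : (u w : Fin n) → ren u w w ≡ u
ren-merged u w = cong (if_then u else w) (==-refl w)

ren-kept : (u w : Fin n) → ren u w u ≡ u
ren-kept u w with u == w
... | true = refl
... | false = refl

ren-other : (u w : Fin n) {s : Fin n} → s ≢ w → ren u w s ≡ s
ren-other u w {s} s≢w = cong (if_then u else s) (≢⇒==-false s≢w)

ren-ends : (u w : Fin n) → ren u w u ≡ ren u w w
ren-ends u w = trans (ren-kept u w) (sym (ren-merged u w))

ren-injective-off : (u w : Fin n) {s t : Fin n} → s ≢ w → t ≢ w → ren u w s ≡ ren u w t → s ≡ t
ren-injective-off u w s≢w t≢w e = trans (sym (ren-other u w s≢w)) (trans e (ren-other u w t≢w))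

ren-fibre : (u w s t : Fin n) → ren u w s ≡ ren u w t → Path ((u , w) ∷ []) s t
ren-fibre u w s t h with s == w in s=w | t == w in t=w
... | true | true = subst (Path _ s) (trans (==-true⇒≡ s=w) (sym (==-true⇒≡ t=w))) here
... | true | false = subst (λ z → Path _ z t) (sym (==-true⇒≡ s=w)) (bwd (here refl) (subst (Path _ u) h here))
... | false | true = subst (λ z → Path _ z t) (sym h) (subst (Path _ u) (sym (==-true⇒≡ t=w)) (fwd (here refl) here))
... | false | false = subst (Path _ s) h here

path-contract⁺ : (u w : Fin n) (G : Graph n) {s t : Fin n} →
  Path ((u , w) ∷ G) s t → Path (contract u w G) (ren u w s) (ren u w t)
path-contract⁺ u w G = path-map (ren u w) λ
  { (here refl) → subst (Path _ (ren u w u)) (ren-ends u w) here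
  ; (there e) → fwd (∈-map⁺ (mapEdge (ren u w)) e) here }

path-contract⁻ : (u w : Fin n) (G : Graph n) {s t : Fin n} →
  Path (contract u w G) (ren u w s) (ren u w t) → Path ((u , w) ∷ G) s t
path-contract⁻ u w G p =
  path-relabel⁻ (ren u w) id (λ e → fwd (there e) here)
    (λ {s} {s′} e → path-mono (λ { (here refl) → here refl ; (there ()) }) (ren-fibre u w s s′ e)) p refl refl

path-contract-detached : (c w : Fin n) (H : Graph n) {s t : Fin n} → ¬ Path H s w → ¬ Path H t w →
  Path (contract c w H) (ren c w s) (ren c w t) ⇔ Path H s t
path-contract-detached c w H ¬sw ¬tw =
  mk⇔ (path-∷-detached ¬sw ¬tw ∘ path-contract⁻ c w H) (path-contract⁺ c w H ∘ path-mono there)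

Ker⊆ : {n′ : ℕ} → (Fin k → Fin n) → (Fin k → Fin n′) → Set
Ker⊆ g h = ∀ s t → g s ≡ g t → h s ≡ h t

path-relabel-ker : {n′ : ℕ} (g : Fin k → Fin n) (h : Fin k → Fin n′) {G : Graph k} → Ker⊆ g h →
  {s t : Fin k} → Path (relabel g G) (g s) (g t) → Path (relabel h G) (h s) (h t)
path-relabel-ker g h gh p =
  path-relabel⁻ g h (λ e → fwd (∈-map⁺ (mapEdge h) e) here)
    (λ {s} {s′} gs≡gs′ → subst (Path _ (h s)) (gh s s′ gs≡gs′) here) p refl refl

ker-contract : {n′ : ℕ} (g : Fin k → Fin n) (h : Fin k → Fin n′) (p q : Fin k) → Ker⊆ g h →
  Ker⊆ (ren (g p) (g q) ∘ g) (ren (h p) (h q) ∘ h)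
ker-contract g h p q gh s t e =
  ≡-along-path (ren (h p) (h q)) (λ { (here refl) → ren-ends (h p) (h q) ; (there ()) })
    (path-relabel-ker g h {(p , q) ∷ []} gh (ren-fibre (g p) (g q) (g s) (g t) e))

ker-ren-swap : (u w : Fin n) → Ker⊆ (ren u w) (ren w u)
ker-ren-swap u w s t e =
  ≡-along-path (ren w u) (λ { (here refl) → sym (ren-ends w u) ; (there ()) }) (ren-fibre u w s t e)

merge₂ : Fin n → Fin n → Fin n → Fin n → Fin n → Fin n
merge₂ p q r s = ren (ren p q r) (ren p q s) ∘ ren p q

merge₂-fibre : (p q r s : Fin n) {z t : Fin n} → merge₂ p q r s z ≡ merge₂ p q r s t → Path ((p , q) ∷ (r , s) ∷ []) z t
merge₂-fibre p q r s {z} {t} e =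
  path-relabel⁻ (ren p q) id {H = (r , s) ∷ []} (λ { (here refl) → fwd (there (here refl)) here ; (there ()) })
    (λ {s₁} {s₂} e′ → path-mono (λ { (here refl) → here refl ; (there ()) }) (ren-fibre p q s₁ s₂ e′))
    (ren-fibre (ren p q r) (ren p q s) (ren p q z) (ren p q t) e) refl refl

merge₂-path : (p q r s : Fin n) {z t : Fin n} → Path ((p , q) ∷ (r , s) ∷ []) z t → merge₂ p q r s z ≡ merge₂ p q r s t
merge₂-path p q r s =
  ≡-along-path (merge₂ p q r s) λ
    { (here refl) → cong (ren (ren p q r) (ren p q s)) (ren-ends p q)
    ; (there (here refl)) → ren-ends (ren p q r) (ren p q s)
    ; (there (there ())) }

-- The deletion–contraction recursion

module TutteProperties {c ℓ : Level} (R : CommutativeRing c ℓ) (x y : CommutativeRing.Carrier R) where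
  open CommutativeRing R renaming (refl to ≈-refl; sym to ≈-sym; trans to ≈-trans; reflexive to ≡⇒≈)
  open Reachability using (path?; reachable?-sound; reachable?-complete)

  tutte : Graph n → Carrier
  tutte = Tutte R x y

  tutteVec-toList : ∀ k {k′} (v : Vec.Vec (Edge n) k) (v′ : Vec.Vec (Edge n) k′) →
    Vec.toList v ≡ Vec.toList v′ → tutteVec R x y k v ≡ tutteVec R x y k′ v′
  tutteVec-toList zero Vec.[] Vec.[] _ = refl
  tutteVec-toList (suc k) ((u , w) Vec.∷ v) (_ Vec.∷ v′) eq with refl , tail-eq ← List.∷-injective eq =
    trans (cong₂ (recursion (reachable? (Vec.toList v) u w))
                 (tutteVec-toList k v v′ tail-eq)
                 (tutteVec-toList k (Vec.map (contractWith u w) v) (Vec.map (contractWith u w) v′) mapped-eq))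
          (cong (λ G → recursion (reachable? G u w) _ _) tail-eq)
    where
      recursion : Bool → Carrier → Carrier → Carrier
      recursion r d t = if u == w then y * d else (if r then d + t else x * t)
      mapped-eq : Vec.toList (Vec.map (contractWith u w) v) ≡ Vec.toList (Vec.map (contractWith u w) v′)
      mapped-eq = trans (Vec.toList-map _ v) (trans (cong (map _) tail-eq) (sym (Vec.toList-map _ v′)))
  tutteVec-toList (suc k) (_ Vec.∷ _) Vec.[] ()

  private
    non-loop : Fin n → Fin n → Graph n → Carrier
    non-loop u w G = if reachable? G u w then tutte G + tutte (contract u w G) else x * tutte (contract u w G)

  tutte-∷ : {u w : Fin n} {G : Graph n} → tutte ((u , w) ∷ G) ≡ (if u == w then y * tutte G else non-loop u w G)
  tutte-∷ {u = u} {w} {G} =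
    cong₂ (λ r t → if u == w then y * tutte G else (if r then tutte G + t else x * t))
      (cong (λ H → reachable? H u w) (Vec.toList∘fromList G))
      (tutteVec-toList _ (Vec.map (contractWith u w) (Vec.fromList G)) (Vec.fromList (contract u w G))
        (trans (Vec.toList-map _ (Vec.fromList G))
          (trans (cong (map _) (Vec.toList∘fromList G)) (sym (Vec.toList∘fromList (contract u w G))))))

  tutte-loop : {u w : Fin n} (G : Graph n) → u ≡ w → tutte ((u , w) ∷ G) ≡ y * tutte G
  tutte-loop {u = u} {w} G refl = trans (tutte-∷ {u = u} {w} {G}) (cong (λ b → if b then y * tutte G else non-loop u w G) (==-refl u))

  tutte-ordinary : {u w : Fin n} (G : Graph n) → u ≢ w → Path G u w →
    tutte ((u , w) ∷ G) ≡ tutte G + tutte (contract u w G)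
  tutte-ordinary {u = u} {w} G u≢w p = trans (tutte-∷ {u = u} {w} {G}) (trans
    (cong (λ b → if b then y * tutte G else non-loop u w G) (≢⇒==-false u≢w))
    (cong (λ b → if b then tutte G + tutte (contract u w G) else x * tutte (contract u w G))
          (to T-≡ (reachable?-complete G p))))

  tutte-bridge : {u w : Fin n} (G : Graph n) → u ≢ w → ¬ Path G u w →
    tutte ((u , w) ∷ G) ≡ x * tutte (contract u w G)
  tutte-bridge {u = u} {w} G u≢w ¬p = trans (tutte-∷ {u = u} {w} {G}) (trans
    (cong (λ b → if b then y * tutte G else non-loop u w G) (≢⇒==-false u≢w))
    (cong (λ b → if b then tutte G + tutte (contract u w G) else x * tutte (contract u w G))
          (¬T⇒≡false (λ t → ¬p (reachable?-sound G t)))))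

  open ≈-Reasoning setoid
  open import Algebra.Properties.CommutativeSemigroup *-commutativeSemigroup using (x∙yz≈y∙xz)
  open import Algebra.Properties.CommutativeSemigroup +-commutativeSemigroup using (interchange)

  tutte-∷-cong : {n′ : ℕ} (u w : Fin n) (u′ w′ : Fin n′) (G : Graph n) (G′ : Graph n′) →
    (u ≡ w ⇔ u′ ≡ w′) → (Path G u w ⇔ Path G′ u′ w′) →
    (Path G u w → tutte G ≈ tutte G′) → tutte (contract u w G) ≈ tutte (contract u′ w′ G′) →
    tutte ((u , w) ∷ G) ≈ tutte ((u′ , w′) ∷ G′)
  tutte-∷-cong u w u′ w′ G G′ loop⇔ path⇔ del con = by-cases (u ≟ w) (path? G u w)
    where
      by-cases : Dec (u ≡ w) → Dec (Path G u w) → tutte ((u , w) ∷ G) ≈ tutte ((u′ , w′) ∷ G′)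
      by-cases (yes u≡w) _ = begin
        tutte ((u , w) ∷ G)    ≡⟨ tutte-loop G u≡w ⟩
        y * tutte G            ≈⟨ *-congˡ (del (subst (Path G u) u≡w here)) ⟩
        y * tutte G′           ≡⟨ tutte-loop G′ (to loop⇔ u≡w) ⟨
        tutte ((u′ , w′) ∷ G′) ∎
      by-cases (no u≢w) (yes p) = begin
        tutte ((u , w) ∷ G)                  ≡⟨ tutte-ordinary G u≢w p ⟩
        tutte G + tutte (contract u w G)     ≈⟨ +-cong (del p) con ⟩
        tutte G′ + tutte (contract u′ w′ G′) ≡⟨ tutte-ordinary G′ (u≢w ∘ from loop⇔) (to path⇔ p) ⟨
        tutte ((u′ , w′) ∷ G′)               ∎
      by-cases (no u≢w) (no ¬p) = begin
        tutte ((u , w) ∷ G)           ≡⟨ tutte-bridge G u≢w ¬p ⟩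
        x * tutte (contract u w G)    ≈⟨ *-congˡ con ⟩
        x * tutte (contract u′ w′ G′) ≡⟨ tutte-bridge G′ (u≢w ∘ from loop⇔) (¬p ∘ from path⇔) ⟨
        tutte ((u′ , w′) ∷ G′)        ∎

  tutte-relabel-ker : {n′ : ℕ} (g : Fin k → Fin n) (h : Fin k → Fin n′) → Ker⊆ g h → Ker⊆ h g →
    (G : Graph k) → tutte (relabel g G) ≈ tutte (relabel h G)
  tutte-relabel-ker g h gh hg [] = ≈-refl
  tutte-relabel-ker g h gh hg ((p , q) ∷ G) =
    tutte-∷-cong (g p) (g q) (h p) (h q) (relabel g G) (relabel h G)
      (mk⇔ (gh p q) (hg p q)) (mk⇔ (path-relabel-ker g h gh) (path-relabel-ker h g hg))
      (λ _ → tutte-relabel-ker g h gh hg G) contracted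
    where
      contracted : tutte (contract (g p) (g q) (relabel g G)) ≈ tutte (contract (h p) (h q) (relabel h G))
      contracted = subst₂ (λ A B → tutte A ≈ tutte B) (relabel-∘ _ g G) (relabel-∘ _ h G)
        (tutte-relabel-ker _ _ (ker-contract g h p q gh) (ker-contract h g p q hg) G)

  tutte-relabel-injective : (f : Fin k → Fin n) → Injective _≡_ _≡_ f → (G : Graph k) → tutte (relabel f G) ≈ tutte G
  tutte-relabel-injective f f-inj G =
    ≈-trans (tutte-relabel-ker f id (λ _ _ → f-inj) (λ _ _ → cong f) G) (≡⇒≈ (cong tutte (List.map-id G)))

  tutte-contract-sym : (u w : Fin n) (G : Graph n) → tutte (contract u w G) ≈ tutte (contract w u G)
  tutte-contract-sym u w = tutte-relabel-ker (ren u w) (ren w u) (ker-ren-swap u w) (ker-ren-swap w u)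

  tutte-flip : (u w : Fin n) (G : Graph n) → tutte ((u , w) ∷ G) ≈ tutte ((w , u) ∷ G)
  tutte-flip u w G = tutte-∷-cong u w w u G G (mk⇔ sym sym) (mk⇔ path-sym path-sym) (λ _ → ≈-refl)
    (tutte-contract-sym u w G)

  -- Two successive contractions only depend on the partition of vertices they induce.
  tutte-contract₂ : (p q r s p′ q′ r′ s′ : Fin n) →
    (∀ {a b} → (a , b) ∈ (p , q) ∷ (r , s) ∷ [] → Path ((p′ , q′) ∷ (r′ , s′) ∷ []) a b) →
    (∀ {a b} → (a , b) ∈ (p′ , q′) ∷ (r′ , s′) ∷ [] → Path ((p , q) ∷ (r , s) ∷ []) a b) →
    (G : Graph n) →
    tutte (contract (ren p q r) (ren p q s) (contract p q G)) ≈
    tutte (contract (ren p′ q′ r′) (ren p′ q′ s′) (contract p′ q′ G))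
  tutte-contract₂ p q r s p′ q′ r′ s′ H⇒H′ H′⇒H G =
    subst₂ (λ A B → tutte A ≈ tutte B) (relabel-∘ _ (ren p q) G) (relabel-∘ _ (ren p′ q′) G)
      (tutte-relabel-ker (merge₂ p q r s) (merge₂ p′ q′ r′ s′)
        (λ z t e → merge₂-path p′ q′ r′ s′ (path-map id H⇒H′ (merge₂-fibre p q r s {z} {t} e)))
        (λ z t e → merge₂-path p q r s (path-map id H′⇒H (merge₂-fibre p′ q′ r′ s′ {z} {t} e))) G)

  tutte-contract-comm : (u w a b : Fin n) (G : Graph n) →
    tutte (contract (ren u w a) (ren u w b) (contract u w G)) ≈ tutte (contract (ren a b u) (ren a b w) (contract a b G))
  tutte-contract-comm u w a b = tutte-contract₂ u w a b a b u w swapped swapped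
    where
      swapped : ∀ {p q r s a′ b′ : Fin n} → (a′ , b′) ∈ (p , q) ∷ (r , s) ∷ [] → Path ((r , s) ∷ (p , q) ∷ []) a′ b′
      swapped (here refl) = fwd (there (here refl)) here
      swapped (there (here refl)) = fwd (here refl) here

  tutte-flip-inner : (a b u w : Fin n) (G : Graph n) → tutte ((a , b) ∷ (u , w) ∷ G) ≈ tutte ((a , b) ∷ (w , u) ∷ G)
  tutte-flip-inner a b u w G =
    tutte-∷-cong a b a b ((u , w) ∷ G) ((w , u) ∷ G) (mk⇔ id id) (mk⇔ (path-map id flipped) (path-map id flipped))
      (λ _ → tutte-flip u w G) (tutte-flip (ren a b u) (ren a b w) (contract a b G))
    where
      flipped : ∀ {p q s t} → (s , t) ∈ (p , q) ∷ G → Path ((q , p) ∷ G) s t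
      flipped (here refl) = bwd (here refl) here
      flipped (there e) = fwd (there e) here

  tutte-inner-loop : (a b u w : Fin n) (G : Graph n) → u ≡ w → tutte ((a , b) ∷ (u , w) ∷ G) ≈ y * tutte ((a , b) ∷ G)
  tutte-inner-loop a b u w G u≡w = by-cases (a ≟ b) (path? G a b)
    where
      loop-image : tutte (contract a b ((u , w) ∷ G)) ≡ y * tutte (contract a b G)
      loop-image = tutte-loop (contract a b G) (cong (ren a b) u≡w)

      by-cases : Dec (a ≡ b) → Dec (Path G a b) → tutte ((a , b) ∷ (u , w) ∷ G) ≈ y * tutte ((a , b) ∷ G)
      by-cases (yes a≡b) _ = begin
        tutte ((a , b) ∷ (u , w) ∷ G) ≡⟨ tutte-loop ((u , w) ∷ G) a≡b ⟩
        y * tutte ((u , w) ∷ G)       ≡⟨ cong (y *_) (tutte-loop G u≡w) ⟩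
        y * (y * tutte G)             ≡⟨ cong (y *_) (tutte-loop G a≡b) ⟨
        y * tutte ((a , b) ∷ G)       ∎
      by-cases (no a≢b) (yes p) = begin
        tutte ((a , b) ∷ (u , w) ∷ G)                        ≡⟨ tutte-ordinary ((u , w) ∷ G) a≢b (path-mono there p) ⟩
        tutte ((u , w) ∷ G) + tutte (contract a b ((u , w) ∷ G)) ≡⟨ cong₂ _+_ (tutte-loop G u≡w) loop-image ⟩
        y * tutte G + y * tutte (contract a b G)             ≈⟨ distribˡ y _ _ ⟨
        y * (tutte G + tutte (contract a b G))               ≡⟨ cong (y *_) (tutte-ordinary G a≢b p) ⟨
        y * tutte ((a , b) ∷ G)                              ∎
      by-cases (no a≢b) (no ¬p) = begin
        tutte ((a , b) ∷ (u , w) ∷ G)       ≡⟨ tutte-bridge ((u , w) ∷ G) a≢b (¬p ∘ path-∷-elim (subst (Path G u) u≡w here)) ⟩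
        x * tutte (contract a b ((u , w) ∷ G)) ≡⟨ cong (x *_) loop-image ⟩
        x * (y * tutte (contract a b G))    ≈⟨ x∙yz≈y∙xz x y _ ⟩
        y * (x * tutte (contract a b G))    ≡⟨ cong (y *_) (tutte-bridge G a≢b ¬p) ⟨
        y * tutte ((a , b) ∷ G)             ∎

  tutte-swap-loop : (u w a b : Fin n) (G : Graph n) → u ≡ w → tutte ((u , w) ∷ (a , b) ∷ G) ≈ tutte ((a , b) ∷ (u , w) ∷ G)
  tutte-swap-loop u w a b G u≡w =
    ≈-trans (≡⇒≈ (tutte-loop ((a , b) ∷ G) u≡w)) (≈-sym (tutte-inner-loop a b u w G u≡w))

  -- With w outside the component of u, contracting u w is a one-point join of two components, and its
  -- Tutte polynomial does not depend on the vertex of that component used for the join.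
  SlideInvariant : Graph n → Set ℓ
  SlideInvariant G = ∀ u a w → Path G u a → ¬ Path G u w → tutte (contract u w G) ≈ tutte (contract a w G)

  module Unfold (u w a b : Fin n) (G : Graph n) (u≢w : u ≢ w) (ab-image : ren u w a ≢ ren u w b) where

    outer-ordinary : Path ((a , b) ∷ G) u w →
      tutte ((u , w) ∷ (a , b) ∷ G) ≡ tutte ((a , b) ∷ G) + tutte (contract u w ((a , b) ∷ G))
    outer-ordinary = tutte-ordinary ((a , b) ∷ G) u≢w

    outer-bridge : ¬ Path ((a , b) ∷ G) u w → tutte ((u , w) ∷ (a , b) ∷ G) ≡ x * tutte (contract u w ((a , b) ∷ G))
    outer-bridge = tutte-bridge ((a , b) ∷ G) u≢w

    inner-ordinary : Path ((u , w) ∷ G) a b →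
      tutte (contract u w ((a , b) ∷ G)) ≡ tutte (contract u w G) + tutte (contract (ren u w a) (ren u w b) (contract u w G))
    inner-ordinary r = tutte-ordinary (contract u w G) ab-image (path-contract⁺ u w G r)

    inner-bridge : ¬ Path ((u , w) ∷ G) a b →
      tutte (contract u w ((a , b) ∷ G)) ≡ x * tutte (contract (ren u w a) (ren u w b) (contract u w G))
    inner-bridge ¬r = tutte-bridge (contract u w G) ab-image (¬r ∘ path-contract⁻ u w G)

  module SwapOrdinary (u w a b : Fin n) (G : Graph n) (slide : SlideInvariant G) (u≢w : u ≢ w) (a≢b : a ≢ b)
                      (not-parallel : ¬ (a ≡ u × b ≡ w)) (not-antiparallel : ¬ (a ≡ w × b ≡ u)) where

    ab-image : ren u w a ≢ ren u w b
    ab-image e with path-single (ren-fibre u w a b e)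
    ... | inj₁ a≡b = a≢b a≡b
    ... | inj₂ (inj₁ q) = not-parallel q
    ... | inj₂ (inj₂ q) = not-antiparallel q

    uw-image : ren a b u ≢ ren a b w
    uw-image e with path-single (ren-fibre a b u w e)
    ... | inj₁ u≡w = u≢w u≡w
    ... | inj₂ (inj₁ (u≡a , w≡b)) = not-parallel (sym u≡a , sym w≡b)
    ... | inj₂ (inj₂ (u≡b , w≡a)) = not-antiparallel (sym w≡a , sym u≡b)

    open Unfold u w a b G u≢w ab-image
    open Unfold a b u w G a≢b uw-image renaming
      (outer-ordinary to outer-ordinary′; outer-bridge to outer-bridge′; inner-ordinary to inner-ordinary′; inner-bridge to inner-bridge′)

    X = tutte G
    A = tutte (contract u w G)
    B = tutte (contract a b G)
    D₁ = tutte (contract (ren u w a) (ren u w b) (contract u w G))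
    D₂ = tutte (contract (ren a b u) (ren a b w) (contract a b G))

    D₁≈D₂ : D₁ ≈ D₂
    D₁≈D₂ = tutte-contract-comm u w a b G

    -- If both edges cross the same cut of G, contracting either one glues the same two components.
    crossing : Path ((a , b) ∷ G) u w → ¬ Path G u w → A ≈ B
    crossing r₁ ¬s₁ with path-∷⁻ r₁
    ... | inj₁ s₁ = ⊥-elim (¬s₁ s₁)
    ... | inj₂ (inj₁ (ua , bw)) = begin
      A                      ≈⟨ slide u a w ua ¬s₁ ⟩
      tutte (contract a w G) ≈⟨ tutte-contract-sym a w G ⟩
      tutte (contract w a G) ≈⟨ slide w b a (path-sym bw) (λ wa → ¬s₁ (path-trans ua (path-sym wa))) ⟩
      tutte (contract b a G) ≈⟨ tutte-contract-sym b a G ⟩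
      B                      ∎
    ... | inj₂ (inj₂ (ub , aw)) = begin
      A                      ≈⟨ slide u b w ub ¬s₁ ⟩
      tutte (contract b w G) ≈⟨ tutte-contract-sym b w G ⟩
      tutte (contract w b G) ≈⟨ slide w a b (path-sym aw) (λ wb → ¬s₁ (path-trans ub (path-sym wb))) ⟩
      B                      ∎

    swap : tutte ((u , w) ∷ (a , b) ∷ G) ≈ tutte ((a , b) ∷ (u , w) ∷ G)
    swap = by-cases (path? ((a , b) ∷ G) u w) (path? ((u , w) ∷ G) a b) (path? G u w)
      where
        by-cases : Dec (Path ((a , b) ∷ G) u w) → Dec (Path ((u , w) ∷ G) a b) → Dec (Path G u w) →
          tutte ((u , w) ∷ (a , b) ∷ G) ≈ tutte ((a , b) ∷ (u , w) ∷ G)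
        by-cases (yes r₁) (yes r₂) (yes s₁) = begin
          tutte ((u , w) ∷ (a , b) ∷ G) ≡⟨ trans (outer-ordinary r₁) (cong₂ _+_ (tutte-ordinary G a≢b s₂) (inner-ordinary r₂)) ⟩
          (X + B) + (A + D₁)            ≈⟨ interchange X B A D₁ ⟩
          (X + A) + (B + D₁)            ≈⟨ +-congˡ (+-congˡ D₁≈D₂) ⟩
          (X + A) + (B + D₂)            ≡⟨ trans (outer-ordinary′ r₂) (cong₂ _+_ (tutte-ordinary G u≢w s₁) (inner-ordinary′ r₁)) ⟨
          tutte ((a , b) ∷ (u , w) ∷ G) ∎
          where s₂ = path-∷-elim s₁ r₂
        by-cases (yes r₁) (yes r₂) (no ¬s₁) = begin
          tutte ((u , w) ∷ (a , b) ∷ G) ≡⟨ trans (outer-ordinary r₁) (cong₂ _+_ (tutte-bridge G a≢b ¬s₂) (inner-ordinary r₂)) ⟩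
          x * B + (A + D₁)              ≈⟨ +-cong (*-congˡ (≈-sym A≈B)) (+-cong A≈B D₁≈D₂) ⟩
          x * A + (B + D₂)              ≡⟨ trans (outer-ordinary′ r₂) (cong₂ _+_ (tutte-bridge G u≢w ¬s₁) (inner-ordinary′ r₁)) ⟨
          tutte ((a , b) ∷ (u , w) ∷ G) ∎
          where ¬s₂ = λ s₂ → ¬s₁ (path-∷-elim s₂ r₁)
                A≈B = crossing r₁ ¬s₁
        by-cases (yes r₁) (no ¬r₂) _ = begin
          tutte ((u , w) ∷ (a , b) ∷ G) ≡⟨ trans (outer-ordinary r₁) (cong₂ _+_ (tutte-bridge G a≢b ¬s₂) (inner-bridge ¬r₂)) ⟩
          x * B + x * D₁                ≈⟨ distribˡ x B D₁ ⟨
          x * (B + D₁)                  ≈⟨ *-congˡ (+-congˡ D₁≈D₂) ⟩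
          x * (B + D₂)                  ≡⟨ trans (outer-bridge′ ¬r₂) (cong (x *_) (inner-ordinary′ r₁)) ⟨
          tutte ((a , b) ∷ (u , w) ∷ G) ∎
          where ¬s₂ = ¬r₂ ∘ path-mono there
        by-cases (no ¬r₁) (yes r₂) _ = begin
          tutte ((u , w) ∷ (a , b) ∷ G) ≡⟨ trans (outer-bridge ¬r₁) (cong (x *_) (inner-ordinary r₂)) ⟩
          x * (A + D₁)                  ≈⟨ *-congˡ (+-congˡ D₁≈D₂) ⟩
          x * (A + D₂)                  ≈⟨ distribˡ x A D₂ ⟩
          x * A + x * D₂                ≡⟨ trans (outer-ordinary′ r₂) (cong₂ _+_ (tutte-bridge G u≢w ¬s₁) (inner-bridge′ ¬r₁)) ⟨
          tutte ((a , b) ∷ (u , w) ∷ G) ∎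
          where ¬s₁ = ¬r₁ ∘ path-mono there
        by-cases (no ¬r₁) (no ¬r₂) _ = begin
          tutte ((u , w) ∷ (a , b) ∷ G) ≡⟨ trans (outer-bridge ¬r₁) (cong (x *_) (inner-bridge ¬r₂)) ⟩
          x * (x * D₁)                  ≈⟨ *-congˡ (*-congˡ D₁≈D₂) ⟩
          x * (x * D₂)                  ≡⟨ trans (outer-bridge′ ¬r₂) (cong (x *_) (inner-bridge′ ¬r₁)) ⟨
          tutte ((a , b) ∷ (u , w) ∷ G) ∎

  tutte-swap : (u w a b : Fin n) (G : Graph n) → SlideInvariant G →
    tutte ((u , w) ∷ (a , b) ∷ G) ≈ tutte ((a , b) ∷ (u , w) ∷ G)
  tutte-swap u w a b G slide = by-cases (u ≟ w) (a ≟ b) ((a ≟ u) ×-dec (b ≟ w)) ((a ≟ w) ×-dec (b ≟ u))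
    where
      by-cases : Dec (u ≡ w) → Dec (a ≡ b) → Dec (a ≡ u × b ≡ w) → Dec (a ≡ w × b ≡ u) →
        tutte ((u , w) ∷ (a , b) ∷ G) ≈ tutte ((a , b) ∷ (u , w) ∷ G)
      by-cases (yes u≡w) _ _ _ = tutte-swap-loop u w a b G u≡w
      by-cases (no _) (yes a≡b) _ _ = ≈-sym (tutte-swap-loop a b u w G a≡b)
      by-cases (no _) (no _) (yes (refl , refl)) _ = ≈-refl
      by-cases (no _) (no _) (no _) (yes (refl , refl)) =
        ≈-trans (tutte-flip-inner u w w u G) (≈-sym (tutte-flip w u ((u , w) ∷ G)))
      by-cases (no u≢w) (no a≢b) (no ¬parallel) (no ¬antiparallel) =
        SwapOrdinary.swap u w a b G slide u≢w a≢b ¬parallel ¬antiparallel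

  PermInvariant : ℕ → Set ℓ
  PermInvariant k = ∀ {n} {G G′ : Graph n} → length G ≤ k → G ↭ G′ → tutte G ≈ tutte G′

  tutte-∷-↭ : {k : ℕ} → PermInvariant k → (u w : Fin n) {xs ys : Graph n} → length xs ≤ k → xs ↭ ys →
    tutte ((u , w) ∷ xs) ≈ tutte ((u , w) ∷ ys)
  tutte-∷-↭ perm u w {xs} {ys} len p =
    tutte-∷-cong u w u w xs ys (mk⇔ id id) (mk⇔ (path-↭ p) (path-↭ (↭-sym p)))
      (λ _ → perm len p) (perm (subst (_≤ _) (sym (List.length-map _ xs)) len) (map⁺ _ p))

  slide-edge : ∀ k → PermInvariant (suc k) → (∀ {n} {G : Graph n} → length G ≤ k → SlideInvariant G) →
    {G : Graph n} → length G ≤ suc k → ∀ u z w → Adjacent G u z → ¬ Path G u w →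
    tutte (contract u w G) ≈ tutte (contract z w G)
  slide-edge {n} k perm slide {G} len u z w adj ¬uw with adjacent⇒↭ adj
  ... | G′ , e , G↭ , oriented = begin
    tutte (contract u w G)                             ≈⟨ edge-first (ren u w) ⟩
    tutte ((ren u w u , ren u w z) ∷ contract u w G′)  ≈⟨ tutte-∷-cong _ _ _ _ _ _ loop⇔ path⇔ deleted contracted ⟩
    tutte ((ren z w u , ren z w z) ∷ contract z w G′)  ≈⟨ edge-first (ren z w) ⟨
    tutte (contract z w G)                             ∎
    where
      len′ : length G′ ≤ k
      len′ = ℕ.≤-pred (subst (_≤ suc k) (↭-length G↭) len)

      edge-first : (f : Fin n → Fin n) → tutte (relabel f G) ≈ tutte ((f u , f z) ∷ relabel f G′)
      edge-first f = ≈-trans (perm (subst (_≤ suc k) (sym (List.length-map _ G)) len) (map⁺ _ G↭)) (orient oriented)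
        where
          orient : e ≡ (u , z) ⊎ e ≡ (z , u) → tutte (mapEdge f e ∷ relabel f G′) ≈ tutte ((f u , f z) ∷ relabel f G′)
          orient (inj₁ e≡uz) = ≡⇒≈ (cong (λ e → tutte (mapEdge f e ∷ relabel f G′)) e≡uz)
          orient (inj₂ e≡zu) = ≈-trans (≡⇒≈ (cong (λ e → tutte (mapEdge f e ∷ relabel f G′)) e≡zu))
                                        (tutte-flip (f z) (f u) (relabel f G′))

      uz : Path G u z
      uz = adjacent⇒path adj

      ¬uw′ : ¬ Path G′ u w
      ¬uw′ = ¬uw ∘ path-mono (∈-resp-↭ (↭-sym G↭) ∘ there)

      ¬zw′ : ¬ Path G′ z w
      ¬zw′ = ¬uw ∘ path-trans uz ∘ path-mono (∈-resp-↭ (↭-sym G↭) ∘ there)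

      u≢w : u ≢ w
      u≢w refl = ¬uw here

      z≢w : z ≢ w
      z≢w refl = ¬uw uz

      loop⇔ : ren u w u ≡ ren u w z ⇔ ren z w u ≡ ren z w z
      loop⇔ = mk⇔ (cong (ren z w) ∘ ren-injective-off u w u≢w z≢w) (cong (ren u w) ∘ ren-injective-off z w u≢w z≢w)

      path⇔ : Path (contract u w G′) (ren u w u) (ren u w z) ⇔ Path (contract z w G′) (ren z w u) (ren z w z)
      path⇔ = ⇔-trans (path-contract-detached u w G′ ¬uw′ ¬zw′) (⇔-sym (path-contract-detached z w G′ ¬uw′ ¬zw′))

      deleted : Path (contract u w G′) (ren u w u) (ren u w z) → tutte (contract u w G′) ≈ tutte (contract z w G′)
      deleted p = slide len′ u z w (to (path-contract-detached u w G′ ¬uw′ ¬zw′) p) ¬uw′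

      contracted : tutte (contract (ren u w u) (ren u w z) (contract u w G′)) ≈
                   tutte (contract (ren z w u) (ren z w z) (contract z w G′))
      contracted = tutte-contract₂ u w u z z w u z
        (λ { (here refl) → fwd (there (here refl)) (fwd (here refl) here)
           ; (there (here refl)) → fwd (there (here refl)) here })
        (λ { (here refl) → bwd (there (here refl)) (fwd (here refl) here)
           ; (there (here refl)) → fwd (there (here refl)) here })
        G′

  slide-invariant : ∀ k → PermInvariant k → {G : Graph n} → length G ≤ k → SlideInvariant G
  slide-invariant zero _ {[]} _ u a w p _ with refl ← path-to-avoided (λ ()) p = ≈-refl
  slide-invariant (suc k) perm {G} len u a w = along
    where
      smaller : ∀ {m} {H : Graph m} → length H ≤ k → SlideInvariant H
      smaller = slide-invariant k (λ l → perm (ℕ.m≤n⇒m≤1+n l))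

      along : ∀ {u a} → Path G u a → ¬ Path G u w → tutte (contract u w G) ≈ tutte (contract a w G)
      along here _ = ≈-refl
      along (fwd e p) ¬uw = ≈-trans (slide-edge k perm smaller len _ _ w (inj₁ e) ¬uw) (along p (¬uw ∘ fwd e))
      along (bwd e p) ¬uw = ≈-trans (slide-edge k perm smaller len _ _ w (inj₂ e) ¬uw) (along p (¬uw ∘ bwd e))

  perm-invariant : ∀ k → PermInvariant k
  perm-invariant zero {G = []} _ p with refl ← ↭-empty-inv (↭-sym p) = ≈-refl
  perm-invariant (suc k) = go
    where
      go : PermInvariant (suc k)
      go _ ↭.refl = ≈-refl
      go (s≤s len) (↭.prep (u , w) p) = tutte-∷-↭ (perm-invariant k) u w len p
      go (s≤s len) (↭.swap {xs} (u , w) (a , b) p) =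
        ≈-trans (tutte-swap u w a b xs (slide-invariant k (perm-invariant k) (ℕ.<⇒≤ len)))
                (tutte-∷-↭ (perm-invariant k) a b len (↭.prep (u , w) p))
      go len (↭.trans p q) = ≈-trans (go len p) (go (subst (_≤ suc k) (↭-length p) len) q)

  tutte-↭ : {G G′ : Graph n} → G ↭ G′ → tutte G ≈ tutte G′
  tutte-↭ {G = G} = perm-invariant (length G) ℕ.≤-refl

avoids-degree-zero : (T : Graph n) (l : Fin n) → degree T l ≡ 0 → Avoids T l
avoids-degree-zero [] l _ ()
avoids-degree-zero ((a , b) ∷ T) l deg with a == l in a=l | b == l in b=l
avoids-degree-zero ((a , b) ∷ T) l deg | false | false = λ
  { (here refl) → ==-false⇒≢ a=l , ==-false⇒≢ b=l
  ; (there e) → avoids-degree-zero T l deg e }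

record LeafEdge {n : ℕ} (T : Graph n) (l : Fin n) : Set where
  field
    before after : Graph n
    edge : Edge n
    other : Fin n
    split : T ≡ before ++ edge ∷ after
    incident : edge ≡ (l , other) ⊎ edge ≡ (other , l)
    other≢l : other ≢ l
    avoids : Avoids (before ++ after) l

leafEdge : (T : Graph n) (l : Fin n) → IsLeaf T l → LeafEdge T l
leafEdge [] l ()
leafEdge ((a , b) ∷ T) l deg with a == l in a=l | b == l in b=l
... | true | true with () ← deg
... | true | false = record
  { before = [] ; after = T ; edge = a , b ; other = b ; split = refl
  ; incident = inj₁ (cong (_, b) (==-true⇒≡ a=l)) ; other≢l = ==-false⇒≢ b=l
  ; avoids = avoids-degree-zero T l (ℕ.suc-injective deg) }
... | false | true = record
  { before = [] ; after = T ; edge = a , b ; other = a ; split = refl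
  ; incident = inj₂ (cong (a ,_) (==-true⇒≡ b=l)) ; other≢l = ==-false⇒≢ a=l
  ; avoids = avoids-degree-zero T l (ℕ.suc-injective deg) }
... | false | false = record
  { before = (a , b) ∷ before ; after = after ; edge = edge ; other = other
  ; split = cong ((a , b) ∷_) split ; incident = incident ; other≢l = other≢l
  ; avoids = λ { (here refl) → ==-false⇒≢ a=l , ==-false⇒≢ b=l ; (there e) → avoids e } }
  where open LeafEdge (leafEdge T l deg)

leaf-neighbour : {T : Graph n} {l v : Fin n} (leaf : LeafEdge T l) → Adjacent T l v → v ≡ LeafEdge.other leaf
leaf-neighbour {T = T} {l} {v} leaf adj = case adj
  where
    open LeafEdge leaf
    T↭ : T ↭ edge ∷ before ++ after
    T↭ = subst (_↭ edge ∷ before ++ after) (sym split) (shift edge before after)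
    case : Adjacent T l v → v ≡ other
    case (inj₁ e) with ∈-resp-↭ T↭ e | incident
    ... | here refl | inj₁ refl = refl
    ... | here refl | inj₂ refl = ⊥-elim (other≢l refl)
    ... | there e′ | _ = ⊥-elim (proj₁ (avoids e′) refl)
    case (inj₂ e) with ∈-resp-↭ T↭ e | incident
    ... | here refl | inj₁ refl = ⊥-elim (other≢l refl)
    ... | here refl | inj₂ refl = refl
    ... | there e′ | _ = ⊥-elim (proj₂ (avoids e′) refl)

deleteEdgeEnds-incident : {m : ℕ} (l a b : Fin (suc m)) → a ≡ l ⊎ b ≡ l → deleteEdgeEnds l (a , b) ≡ nothing
deleteEdgeEnds-incident l a b incident with l ≟ a | l ≟ b
... | yes _ | _ = refl
... | no _ | yes _ = refl
deleteEdgeEnds-incident l a b (inj₁ a≡l) | no l≢a | no _ = ⊥-elim (l≢a (sym a≡l))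
deleteEdgeEnds-incident l a b (inj₂ b≡l) | no _ | no l≢b = ⊥-elim (l≢b (sym b≡l))

deleteVertex-incident : {m : ℕ} (l : Fin (suc m)) (L₁ L₂ : Graph (suc m)) (e : Edge (suc m)) →
  deleteEdgeEnds l e ≡ nothing → deleteVertex (L₁ ++ e ∷ L₂) l ≡ deleteVertex (L₁ ++ L₂) l
deleteVertex-incident l L₁ L₂ e deleted = begin
  mapMaybe (deleteEdgeEnds l) (L₁ ++ e ∷ L₂)                       ≡⟨ List.mapMaybe-++ _ L₁ (e ∷ L₂) ⟩
  mapMaybe (deleteEdgeEnds l) L₁ ++ mapMaybe (deleteEdgeEnds l) (e ∷ L₂)
    ≡⟨ cong (λ z → mapMaybe (deleteEdgeEnds l) L₁ ++ catMaybes (z ∷ map (deleteEdgeEnds l) L₂)) deleted ⟩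
  mapMaybe (deleteEdgeEnds l) L₁ ++ mapMaybe (deleteEdgeEnds l) L₂ ≡⟨ List.mapMaybe-++ _ L₁ L₂ ⟨
  mapMaybe (deleteEdgeEnds l) (L₁ ++ L₂)                           ∎
  where open ≡-Reasoning

relabel-punchIn-deleteVertex : {m : ℕ} (l : Fin (suc m)) (H : Graph (suc m)) → Avoids H l →
  relabel (punchIn l) (deleteVertex H l) ≡ H
relabel-punchIn-deleteVertex l [] _ = refl
relabel-punchIn-deleteVertex l ((a , b) ∷ H) av with l ≟ a | l ≟ b
... | yes l≡a | _ = ⊥-elim (proj₁ (av (here refl)) (sym l≡a))
... | no _ | yes l≡b = ⊥-elim (proj₂ (av (here refl)) (sym l≡b))
... | no l≢a | no l≢b =
  cong₂ _∷_ (cong₂ _,_ (Fin.punchIn-punchOut l≢a) (Fin.punchIn-punchOut l≢b))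
            (relabel-punchIn-deleteVertex l H (av ∘ there))

relabel-punchIn-avoids : {m : ℕ} (i : Fin (suc m)) (H : Graph m) → Avoids (relabel (punchIn i) H) i
relabel-punchIn-avoids i H e with (a , b) , _ , refl ← ∈-map⁻ (mapEdge (punchIn i)) e =
  Fin.punchInᵢ≢i i a , Fin.punchInᵢ≢i i b

contract-avoided : (u w : Fin n) (H : Graph n) → Avoids H w → contract u w H ≡ H
contract-avoided u w [] _ = refl
contract-avoided u w ((a , b) ∷ H) av =
  cong₂ _∷_ (cong₂ _,_ (ren-other u w (proj₁ (av (here refl)))) (ren-other u w (proj₂ (av (here refl)))))
            (contract-avoided u w H (av ∘ there))

-- Cones

spoke : Fin n → Edge (suc n)
spoke i = fz , fs i

tabulate-↭ : ∀ {a} {A : Set a} {k : ℕ} (f : Fin (suc k) → A) (i : Fin (suc k)) →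
  tabulate f ↭ f i ∷ tabulate (f ∘ punchIn i)
tabulate-↭ f fz = ↭.refl
tabulate-↭ {k = suc k} f (fs i) = ↭.trans (↭.prep (f fz) (tabulate-↭ (f ∘ fs) i)) (↭.swap (f fz) (f (fs i)) ↭.refl)

relabel-punchIn-Cone : {m : ℕ} (l : Fin (suc m)) (D : Graph m) →
  relabel (punchIn (fs l)) (Cone D) ≡ relabel fs (relabel (punchIn l) D) ++ tabulate (spoke ∘ punchIn l)
relabel-punchIn-Cone {m} l D =
  trans (List.map-++ _ (relabel fs D) (map spoke (allFin m)))
        (cong₂ _++_ (trans (sym (relabel-∘ (punchIn (fs l)) fs D)) (relabel-∘ fs (punchIn l) D))
                    (trans (sym (List.map-∘ (allFin m))) (List.map-tabulate id _)))

Cone-split : {m : ℕ} (l : Fin (suc m)) (L₁ L₂ : Graph (suc m)) (e : Edge (suc m)) →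
  deleteEdgeEnds l e ≡ nothing → Avoids (L₁ ++ L₂) l →
  Cone (L₁ ++ e ∷ L₂) ↭ mapEdge fs e ∷ spoke l ∷ relabel (punchIn (fs l)) (Cone (deleteVertex (L₁ ++ e ∷ L₂) l))
Cone-split {m} l L₁ L₂ e deleted av = begin
  relabel fs (L₁ ++ e ∷ L₂) ++ map spoke (allFin (suc m))
    ≡⟨ cong (relabel fs (L₁ ++ e ∷ L₂) ++_) (List.map-tabulate id spoke) ⟩
  relabel fs (L₁ ++ e ∷ L₂) ++ tabulate spoke
    ↭⟨ ++⁺ (map⁺ (mapEdge fs) (shift e L₁ L₂)) (tabulate-↭ spoke l) ⟩
  mapEdge fs e ∷ relabel fs (L₁ ++ L₂) ++ spoke l ∷ tabulate (spoke ∘ punchIn l)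
    ↭⟨ ↭.prep (mapEdge fs e) (shift (spoke l) (relabel fs (L₁ ++ L₂)) _) ⟩
  mapEdge fs e ∷ spoke l ∷ relabel fs (L₁ ++ L₂) ++ tabulate (spoke ∘ punchIn l)
    ≡⟨ cong (λ H → mapEdge fs e ∷ spoke l ∷ relabel fs H ++ tabulate (spoke ∘ punchIn l)) deleted-relabelled ⟨
  mapEdge fs e ∷ spoke l ∷ relabel fs (relabel (punchIn l) D) ++ tabulate (spoke ∘ punchIn l)
    ≡⟨ cong (λ H → mapEdge fs e ∷ spoke l ∷ H) (relabel-punchIn-Cone l D) ⟨
  mapEdge fs e ∷ spoke l ∷ relabel (punchIn (fs l)) (Cone D) ∎
  where
    open ↭.PermutationReasoning
    D = deleteVertex (L₁ ++ e ∷ L₂) l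
    deleted-relabelled : relabel (punchIn l) D ≡ L₁ ++ L₂
    deleted-relabelled = trans (cong (relabel (punchIn l)) (deleteVertex-incident l L₁ L₂ e deleted))
                               (relabel-punchIn-deleteVertex l (L₁ ++ L₂) av)

module ConeIdentities {c ℓ : Level} (R : CommutativeRing c ℓ) (x y : CommutativeRing.Carrier R)
  {m : ℕ} (T : Graph (suc m)) (l : Fin (suc m)) (leaf : LeafEdge T l)
  (v′ : Fin m) (v′↦other : punchIn l v′ ≡ LeafEdge.other leaf) where

  open CommutativeRing R renaming (refl to ≈-refl; sym to ≈-sym; trans to ≈-trans; reflexive to ≡⇒≈)
  open TutteProperties R x y
  open LeafEdge leaf
  open ≈-Reasoning setoid

  D : Graph m
  D = deleteVertex T l

  Rest : Graph (suc (suc m))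
  Rest = relabel (punchIn (fs l)) (Cone D)

  leaf-edge : Edge (suc (suc m))
  leaf-edge = fs other , fs l

  embed-injective : Injective _≡_ _≡_ (punchIn (fs l))
  embed-injective = Fin.punchIn-injective (fs l) _ _

  tutte-Rest : tutte Rest ≈ tutte (Cone D)
  tutte-Rest = tutte-relabel-injective (punchIn (fs l)) embed-injective (Cone D)

  tutte-spoke-Rest : tutte (spoke other ∷ Rest) ≈ tutte (ConePlus v′ D)
  tutte-spoke-Rest = begin
    tutte (spoke other ∷ Rest)                        ≡⟨ cong (λ o → tutte (spoke o ∷ Rest)) v′↦other ⟨
    tutte (relabel (punchIn (fs l)) (ConePlus v′ D))  ≈⟨ tutte-relabel-injective (punchIn (fs l)) embed-injective (ConePlus v′ D) ⟩
    tutte (ConePlus v′ D)                             ∎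

  Rest-avoids : Avoids Rest (fs l)
  Rest-avoids = relabel-punchIn-avoids (fs l) (Cone D)

  spoke-other∈Rest : spoke other ∈ Rest
  spoke-other∈Rest = subst (λ o → spoke o ∈ Rest) v′↦other
    (∈-map⁺ (mapEdge (punchIn (fs l))) (∈-++⁺ʳ (relabel fs D) (∈-map⁺ spoke (∈-allFin v′))))

  fs-other≢fs-l : fs other ≢ fs l
  fs-other≢fs-l = other≢l ∘ Fin.suc-injective

  Cone-↭ : Cone T ↭ mapEdge fs edge ∷ spoke l ∷ Rest
  Cone-↭ = subst (λ H → Cone H ↭ mapEdge fs edge ∷ spoke l ∷ relabel (punchIn (fs l)) (Cone (deleteVertex H l)))
    (sym split) (Cone-split l before after edge edge-deleted avoids)
    where
      edge-deleted : deleteEdgeEnds l edge ≡ nothing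
      edge-deleted with incident
      ... | inj₁ refl = deleteEdgeEnds-incident l l other (inj₁ refl)
      ... | inj₂ refl = deleteEdgeEnds-incident l other l (inj₂ refl)

  tutte-orient-leaf-edge : (H : Graph (suc (suc m))) → tutte (mapEdge fs edge ∷ H) ≈ tutte (leaf-edge ∷ H)
  tutte-orient-leaf-edge H with incident
  ... | inj₁ refl = tutte-flip (fs l) (fs other) H
  ... | inj₂ refl = ≈-refl

  tutte-Cone : tutte (Cone T) ≈ tutte (leaf-edge ∷ spoke l ∷ Rest)
  tutte-Cone = ≈-trans (tutte-↭ Cone-↭) (tutte-orient-leaf-edge (spoke l ∷ Rest))

  tutte-ConePlus : tutte (ConePlus l T) ≈ tutte (spoke l ∷ leaf-edge ∷ spoke l ∷ Rest)
  tutte-ConePlus with incident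
  ... | inj₁ refl = ≈-trans (tutte-↭ (↭.prep (spoke l) Cone-↭)) (tutte-flip-inner fz (fs l) (fs l) (fs other) (spoke l ∷ Rest))
  ... | inj₂ refl = tutte-↭ (↭.prep (spoke l) Cone-↭)

  tutte-Cone-leaf : tutte (Cone T) ≈ x * tutte (Cone D) + tutte (ConePlus v′ D)
  tutte-Cone-leaf = begin
    tutte (Cone T)
      ≈⟨ tutte-Cone ⟩
    tutte (leaf-edge ∷ spoke l ∷ Rest)
      ≡⟨ tutte-ordinary {u = fs other} {fs l} (spoke l ∷ Rest) fs-other≢fs-l other-to-l ⟩
    tutte (spoke l ∷ Rest) + tutte (contract (fs other) (fs l) (spoke l ∷ Rest))
      ≡⟨ cong₂ _+_ pendant doubled ⟩
    x * tutte Rest + tutte (spoke other ∷ Rest)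
      ≈⟨ +-cong (*-congˡ tutte-Rest) tutte-spoke-Rest ⟩
    x * tutte (Cone D) + tutte (ConePlus v′ D) ∎
    where
      other-to-l : Path (spoke l ∷ Rest) (fs other) (fs l)
      other-to-l = bwd (there spoke-other∈Rest) (fwd (here refl) here)

      pendant : tutte (spoke l ∷ Rest) ≡ x * tutte Rest
      pendant = trans (tutte-bridge {u = fz} {fs l} Rest (λ ()) (Fin.0≢1+n ∘ path-to-avoided Rest-avoids))
                      (cong (λ H → x * tutte H) (contract-avoided fz (fs l) Rest Rest-avoids))

      doubled : tutte (contract (fs other) (fs l) (spoke l ∷ Rest)) ≡ tutte (spoke other ∷ Rest)
      doubled = cong tutte (cong₂ _∷_ (cong₂ _,_ (ren-other (fs other) (fs l) {fz} (λ ())) (ren-merged (fs other) (fs l)))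
                                      (contract-avoided (fs other) (fs l) Rest Rest-avoids))

  tutte-ConePlus-leaf : tutte (ConePlus l T) ≈ tutte (Cone T) + y * tutte (ConePlus v′ D)
  tutte-ConePlus-leaf = begin
    tutte (ConePlus l T)
      ≈⟨ tutte-ConePlus ⟩
    tutte (spoke l ∷ leaf-edge ∷ spoke l ∷ Rest)
      ≡⟨ tutte-ordinary {u = fz} {fs l} (leaf-edge ∷ spoke l ∷ Rest) (λ ()) (fwd (there (here refl)) here) ⟩
    tutte (leaf-edge ∷ spoke l ∷ Rest) + tutte (contract fz (fs l) (leaf-edge ∷ spoke l ∷ Rest))
      ≈⟨ +-cong (≈-sym tutte-Cone) looped ⟩
    tutte (Cone T) + y * tutte (ConePlus v′ D) ∎
    where
      looped : tutte (contract fz (fs l) (leaf-edge ∷ spoke l ∷ Rest)) ≈ y * tutte (ConePlus v′ D)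
      looped = begin
        tutte (contract fz (fs l) (leaf-edge ∷ spoke l ∷ Rest))
          ≈⟨ tutte-inner-loop (ren fz (fs l) (fs other)) (ren fz (fs l) (fs l)) (ren fz (fs l) fz) (ren fz (fs l) (fs l))
               (contract fz (fs l) Rest) (ren-ends fz (fs l)) ⟩
        y * tutte ((ren fz (fs l) (fs other) , ren fz (fs l) (fs l)) ∷ contract fz (fs l) Rest)
          ≡⟨ cong (λ H → y * tutte H) (cong₂ _∷_ (cong₂ _,_ (ren-other fz (fs l) fs-other≢fs-l) (ren-merged fz (fs l)))
                                                 (contract-avoided fz (fs l) Rest Rest-avoids)) ⟩
        y * tutte ((fs other , fz) ∷ Rest)  ≈⟨ *-congˡ (tutte-flip (fs other) fz Rest) ⟩
        y * tutte (spoke other ∷ Rest)      ≈⟨ *-congˡ tutte-spoke-Rest ⟩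
        y * tutte (ConePlus v′ D)           ∎

proposition3p5 : ∀ {c ℓ : Level} (R : CommutativeRing c ℓ) →
    let open CommutativeRing R in
    ∀ (x y : Carrier) {m : ℕ} (T : Graph (suc m)) → IsTree T →
    ∀ (l : Fin (suc m)) → IsLeaf T l →
    ∀ (v : Fin (suc m)) (v' : Fin m) → Adjacent T l v → punchIn l v' ≡ v →
    (Tutte R x y (Cone T) ≈ x * Tutte R x y (Cone (deleteVertex T l)) + Tutte R x y (ConePlus v' (deleteVertex T l)))
    × (Tutte R x y (ConePlus l T) ≈ Tutte R x y (Cone T) + y * Tutte R x y (ConePlus v' (deleteVertex T l)))
    × (Tutte R 1# y (Cone T) ≈ Tutte R 1# y (Cone (deleteVertex T l)) + Tutte R 1# y (ConePlus v' (deleteVertex T l)))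
    × (Tutte R 1# y (ConePlus l T) ≈ Tutte R 1# y (Cone T) + y * Tutte R 1# y (ConePlus v' (deleteVertex T l)))
proposition3p5 R x y T _ l leaf v v′ adj v′↦v =
  Cone-leaf x , ConePlus-leaf x , ≈-trans (Cone-leaf 1#) (+-congʳ (*-identityˡ _)) , ConePlus-leaf 1#
  where
    open CommutativeRing R using (Carrier; 1#; +-congʳ; *-identityˡ) renaming (trans to ≈-trans)
    decomposition = leafEdge T l leaf
    module Identities (x′ : Carrier) =
      ConeIdentities R x′ y T l decomposition v′ (trans v′↦v (leaf-neighbour decomposition adj))
    open Identities using () renaming (tutte-Cone-leaf to Cone-leaf; tutte-ConePlus-leaf to ConePlus-leaf)
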